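{- Let $\bar n$ be a sequence of natural numbers and $r_{\bar n}$ the corresponding rotary permutation. Then $d\in\mathcal P(\mathbb N)/\mathrm{Fin}$ satisfies $\alpha_{\bar n}(d)=d$ if and only if $d=[D]_{\mathrm{Fin}}$ for some $D\subseteq\mathbb N$ that is a union of $r_{\bar n}$-orbits. Furthermore, if $d\neq[\emptyset]_{\mathrm{Fin}}$ and $\alpha_{\bar n}(d)=d$, then the restriction of $\alpha_{\bar n}$ to $\{x\in\mathcal P(\mathbb N)/\mathrm{Fin}: x\le d\}$ is conjugate to $\alpha_{\bar m}$ for some subsequence $\bar m$ of $\bar n$, i.e., there is a Boolean algebra isomorphism $\phi:\mathcal P(\mathbb N)/\mathrm{Fin}\to\{x:x\le d\}$ with $\phi\circ\alpha_{\bar m}=\alpha_{\bar n}\circ\phi$.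
   Context: For a sequence $\bar n=(n_j)$, let $I_k=[\sum_{i<k}n_i,\sum_{i\le k}n_i)$ be consecutive intervals of $\mathbb N$; the rotary permutation $r_{\bar n}$ maps $i\mapsto i+1$ unless $i=\max I_k$, and $\max I_k\mapsto\min I_k$, so its orbits are the sets $I_k$. $\alpha_{\bar n}$ is the automorphism $[A]_{\mathrm{Fin}}\mapsto[r_{\bar n}[A]]_{\mathrm{Fin}}$ of $\mathcal P(\mathbb N)/\mathrm{Fin}$. -}

module Defs where

open import Level using (0ℓ)
open import Data.Nat using (ℕ; zero; suc; _+_; _≤_; _<_)
open import Data.Product using (Σ; _×_; _,_)
open import Data.Sum using (_⊎_)
open import Relation.Binary.PropositionalEquality using (_≡_)
open import Relation.Unary using (Pred; _∩_; _∪_; ∁)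

Subset : Set₁
Subset = Pred ℕ 0ℓ

-- start n k = Σ_{i<k} n_i ; so I_k = [start n k , start n (suc k))
start : (ℕ → ℕ) → ℕ → ℕ
start n zero = 0
start n (suc k) = start n k + n k

InI : (ℕ → ℕ) → ℕ → ℕ → Set
InI n k i = (start n k ≤ i) × (i < start n (suc k))

-- Graph of the rotary permutation r_n : i ↦ i+1 unless i = max I_k, max I_k ↦ min I_k
Rot : (ℕ → ℕ) → ℕ → ℕ → Set
Rot n i j = Σ ℕ λ k → InI n k i ×
  (((suc i < start n (suc k)) × (j ≡ suc i)) ⊎ ((suc i ≡ start n (suc k)) × (j ≡ start n k)))

α : (ℕ → ℕ) → Subset → Subset
α n A j = Σ ℕ λ i → A i × Rot n i j

-- equality modulo Fin : A =* B  iff  A Δ B is finite (they agree from some point on)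
_=*_ : Subset → Subset → Set
A =* B = Σ ℕ λ N → ∀ i → N ≤ i → ((A i → B i) × (B i → A i))

-- order of P(ℕ)/Fin : A ⊆* B iff A ∖ B is finite
_≤*_ : Subset → Subset → Set
A ≤* B = Σ ℕ λ N → ∀ i → N ≤ i → A i → B i

-- D is a union of r_n-orbits (the orbits are the intervals I_k)
UnionOfOrbits : (ℕ → ℕ) → Subset → Set
UnionOfOrbits n D = ∀ k i j → InI n k i → InI n k j → D i → D j

Subsequence : (ℕ → ℕ) → (ℕ → ℕ) → Set
Subsequence m n = Σ (ℕ → ℕ) λ σ → (∀ j → σ j < σ (suc j)) × (∀ j → m j ≡ n (σ j))

-- φ (acting on representatives) induces a Boolean algebra isomorphism
-- P(ℕ)/Fin → {x : x ≤ [d]} with φ ∘ α_m = α_n ∘ φ.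
record IsConjugacy (n m : ℕ → ℕ) (d : Subset) (φ : Subset → Subset) : Set₁ where
  field
    resp    : ∀ x y → x =* y → φ x =* φ y
    below   : ∀ x → φ x ≤* d
    pres-∩  : ∀ x y → φ (x ∩ y) =* (φ x ∩ φ y)
    pres-∪  : ∀ x y → φ (x ∪ y) =* (φ x ∪ φ y)
    pres-∁  : ∀ x → φ (∁ x) =* (d ∩ ∁ (φ x))
    inj     : ∀ x y → φ x =* φ y → x =* y
    surj    : ∀ y → y ≤* d → Σ Subset λ x → φ x =* y
    comm    : ∀ x → φ (α m x) =* α n (φ x)

module Submission where

-- The orbits of r_n are the blocks I_k, every i is uniquely start k + t with t < n_k, and
-- on these coordinates r_n is t ↦ t + 1 mod n_k. If r_n[A] =* A then beyond some block
-- each I_k lies inside A or is disjoint from it, which gives the first part. For the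
-- second, excluded middle lets us enumerate the infinitely many full blocks increasingly
-- as I_{σ 0}, I_{σ 1}, …, so that A =* ⋃ⱼ I_{σ j}. For m = n ∘ σ the increasing bijection
-- ψ from ℕ onto ⋃ⱼ I_{σ j} sending start_m j + t to start_n (σ j) + t intertwines r_m and
-- r_n, and x ↦ ψ[x] is the required isomorphism onto the elements below [A].

open import Defs
open import Level using (0ℓ)
open import Axiom.ExcludedMiddle using (ExcludedMiddle)
open import Axiom.DoubleNegationElimination using (em⇒dne)
open import Data.Nat
open import Data.Nat.Properties
open import Data.Product using (Σ; _×_; _,_; proj₁; proj₂; swap)
open import Data.Sum using (_⊎_; inj₁; inj₂)
open import Data.Unit using (tt)
open import Function using (_∘_)
open import Relation.Binary.Definitions using (tri<; tri≈; tri>)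
open import Relation.Binary.PropositionalEquality using (_≡_; refl; sym; trans; cong; subst; module ≡-Reasoning)
open import Relation.Nullary using (¬_; yes; no; contradiction)
open import Relation.Unary using (Decidable; ∅; U; _∩_; _∪_; ∁; _⊢_)

private variable
  A B C D x y : Subset
  n m : ℕ → ℕ
  i j k k' N t t' : ℕ

Eventually : (ℕ → Set) → Set
Eventually P = Σ ℕ λ N → ∀ i → N ≤ i → P i

always : {P : ℕ → Set} → (∀ i → P i) → Eventually P
always p = 0 , λ i _ → p i

eventually-map : {P Q : ℕ → Set} → (∀ {i} → P i → Q i) → Eventually P → Eventually Q
eventually-map f (N , p) = N , λ i N≤i → f (p i N≤i)

eventually-zip : {P Q : ℕ → Set} → Eventually P → Eventually Q → Eventually (λ i → P i × Q i)
eventually-zip (M , p) (N , q) =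
  M ⊔ N , λ i M⊔N≤i → p i (≤-trans (m≤m⊔n M N) M⊔N≤i) , q i (≤-trans (m≤n⊔m M N) M⊔N≤i)

=*-sym : A =* B → B =* A
=*-sym = eventually-map swap

=*-trans : A =* B → B =* C → A =* C
=*-trans A≈B B≈C = eventually-map (λ ((f , g) , (h , k)) → h ∘ f , g ∘ k) (eventually-zip A≈B B≈C)

≤*-resp-=* : A ≤* B → B =* C → A ≤* C
≤*-resp-=* A≤B B≈C = eventually-map (λ (f , (g , _)) → g ∘ f) (eventually-zip A≤B B≈C)

∩-congˡ-=* : A =* B → (A ∩ C) =* (B ∩ C)
∩-congˡ-=* = eventually-map λ (f , g) → (λ (a , c) → f a , c) , (λ (b , c) → g b , c)

StrictlyIncreasing : (ℕ → ℕ) → Set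
StrictlyIncreasing f = ∀ {p q} → p < q → f p < f q

module _ {f : ℕ → ℕ} where

  suc-increasing⇒strictly-increasing : (∀ k → f k < f (suc k)) → StrictlyIncreasing f
  suc-increasing⇒strictly-increasing f-suc p<q = go (<⇒<′ p<q)
    where
    go : ∀ {p q} → p <′ q → f p < f q
    go <′-base        = f-suc _
    go (<′-step p<′q) = <-trans (go p<′q) (f-suc _)

  module _ (f-increasing : StrictlyIncreasing f) where

    strictly-increasing⇒monotone : ∀ {p q} → p ≤ q → f p ≤ f q
    strictly-increasing⇒monotone p≤q with m≤n⇒m<n∨m≡n p≤q
    ... | inj₁ p<q  = <⇒≤ (f-increasing p<q)
    ... | inj₂ refl = ≤-refl

    strictly-increasing-reflects-≤ : ∀ {p q} → f p ≤ f q → p ≤ q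
    strictly-increasing-reflects-≤ fp≤fq = ≮⇒≥ λ q<p → <⇒≱ (f-increasing q<p) fp≤fq

    strictly-increasing⇒injective : ∀ {p q} → f p ≡ f q → p ≡ q
    strictly-increasing⇒injective {p} {q} fp≡fq with <-cmp p q
    ... | tri< p<q _ _ = contradiction fp≡fq (<⇒≢ (f-increasing p<q))
    ... | tri≈ _ p≡q _ = p≡q
    ... | tri> _ _ q<p = contradiction (sym fp≡fq) (<⇒≢ (f-increasing q<p))

    strictly-increasing⇒inflationary : ∀ p → p ≤ f p
    strictly-increasing⇒inflationary zero    = z≤n
    strictly-increasing⇒inflationary (suc p) =
      ≤-<-trans (strictly-increasing⇒inflationary p) (f-increasing (n<1+n p))

module Enumeration {P : ℕ → Set} (P? : Decidable P) (unbounded : ∀ s → Σ ℕ λ k → s ≤ k × P k) where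

  record Least≥ (s : ℕ) : Set where
    field
      element : ℕ
      bound   : s ≤ element
      holds   : P element
      minimal : ∀ {k} → s ≤ k → P k → element ≤ k

  open Least≥

  private
    start-is-least : ∀ {s} → P s → Least≥ s
    start-is-least Ps = record { element = _ ; bound = ≤-refl ; holds = Ps ; minimal = λ s≤k _ → s≤k }

    search : ∀ s d → P (s + d) → Least≥ s
    search s zero    P[s+d] = start-is-least (subst P (+-identityʳ s) P[s+d])
    search s (suc d) P[s+d] with P? s
    ... | yes Ps = start-is-least Ps
    ... | no ¬Ps = record { element = element later ; bound = <⇒≤ (bound later)
                          ; holds = holds later ; minimal = minimal-from-s }
      where
      later : Least≥ (suc s)
      later = search (suc s) d (subst P (+-suc s d) P[s+d])
      minimal-from-s : ∀ {k} → s ≤ k → P k → element later ≤ k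
      minimal-from-s s≤k Pk with m≤n⇒m<n∨m≡n s≤k
      ... | inj₁ s<k  = minimal later s<k Pk
      ... | inj₂ refl = contradiction Pk ¬Ps

  least≥ : ∀ s → Least≥ s
  least≥ s with unbounded s
  ... | k , s≤k , Pk = search s (k ∸ s) (subst P (sym (m+[n∸m]≡n s≤k)) Pk)

  enum : ℕ → ℕ
  enum zero    = element (least≥ 0)
  enum (suc j) = element (least≥ (suc (enum j)))

  enum-holds : ∀ j → P (enum j)
  enum-holds zero    = holds (least≥ 0)
  enum-holds (suc j) = holds (least≥ (suc (enum j)))

  enum-increasing : StrictlyIncreasing enum
  enum-increasing = suc-increasing⇒strictly-increasing λ j → bound (least≥ (suc (enum j)))

  enum-surjective : ∀ {k} → P k → Σ ℕ λ j → enum j ≡ k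
  enum-surjective {k} Pk = go k (strictly-increasing⇒inflationary enum-increasing k)
    where
    go : ∀ j → k ≤ enum j → Σ ℕ λ j' → enum j' ≡ k
    go zero k≤enum = zero , ≤-antisym (minimal (least≥ 0) z≤n Pk) k≤enum
    go (suc j) k≤enum with k ≤? enum j
    ... | yes k≤enum-j = go j k≤enum-j
    ... | no  k≰enum-j = suc j , ≤-antisym (minimal (least≥ _) (≰⇒> k≰enum-j) Pk) k≤enum

rotate : ℕ → ℕ → ℕ
rotate c t with suc t <? c
... | yes _ = suc t
... | no  _ = 0

rotate-suc : ∀ {c} → suc t < c → rotate c t ≡ suc t
rotate-suc {t} {c} 1+t<c with suc t <? c
... | yes _     = refl
... | no 1+t≮c = contradiction 1+t<c 1+t≮c

rotate-last : ∀ {c} → suc t ≡ c → rotate c t ≡ 0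
rotate-last {t} {c} 1+t≡c with suc t <? c
... | yes 1+t<c = contradiction 1+t≡c (<⇒≢ 1+t<c)
... | no  _     = refl

rotate-< : ∀ {c} → 0 < c → rotate c t < c
rotate-< {t} {c} 0<c with suc t <? c
... | yes 1+t<c = 1+t<c
... | no  _     = 0<c

rotate-surjective : ∀ {c} → t < c → Σ ℕ λ t' → t' < c × rotate c t' ≡ t
rotate-surjective {zero}  {suc c} _     = c , ≤-refl , rotate-last refl
rotate-surjective {suc t}         1+t<c = t , <-trans (n<1+n t) 1+t<c , rotate-suc 1+t<c

rotate-invariant⇒constant : ∀ {c} (X : ℕ → Set) → (∀ {t} → t < c → X t → X (rotate c t)) →
  t < c → t' < c → X t → X t'
rotate-invariant⇒constant {c = suc l} X invariant t<c t'<c Xt =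
  climb z≤′n t'<c (wrap (climb (≤⇒≤′ (≤-pred t<c)) ≤-refl Xt))
  where
  climb : ∀ {t u} → t ≤′ u → u < suc l → X t → X u
  climb ≤′-refl          _     Xt = Xt
  climb (≤′-step t≤′u) 1+u<c Xt =
    subst X (rotate-suc 1+u<c) (invariant u<c (climb t≤′u u<c Xt))
    where
    u<c : _ < suc l
    u<c = <-trans (n<1+n _) 1+u<c
  wrap : X l → X 0
  wrap Xl = subst X (rotate-last refl) (invariant ≤-refl Xl)

module Blocks (n : ℕ → ℕ) (n>0 : ∀ k → 0 < n k) where

  start-increasing : StrictlyIncreasing (start n)
  start-increasing = suc-increasing⇒strictly-increasing λ k →
    subst (_< start n (suc k)) (+-identityʳ _) (+-monoʳ-< (start n k) (n>0 k))

  block≤position : ∀ k t → k ≤ start n k + t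
  block≤position k t = ≤-trans (strictly-increasing⇒inflationary start-increasing k) (m≤m+n _ t)

  Coordinates : ℕ → Set
  Coordinates i = Σ ℕ λ k → Σ ℕ λ t → t < n k × i ≡ start n k + t

  block-< : k < k' → t < n k → start n k + t < start n k' + t'
  block-< {k} {t = t} k<k' t<nk =
    <-≤-trans (+-monoʳ-< (start n k) t<nk)
              (≤-trans (strictly-increasing⇒monotone start-increasing k<k') (m≤m+n _ _))

  block-≤ : start n N ≤ start n k + t → t < n k → N ≤ k
  block-≤ {N} {k} {t} start≤i t<nk = ≮⇒≥ λ k<N →
    <⇒≱ (subst (start n k + t <_) (+-identityʳ _) (block-< k<N t<nk)) start≤i

  coordinates-unique : t < n k → t' < n k' → start n k + t ≡ start n k' + t' → k ≡ k' × t ≡ t'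
  coordinates-unique {k = k} {k' = k'} t<nk t'<nk' eq with <-cmp k k'
  ... | tri< k<k' _ _ = contradiction eq (<⇒≢ (block-< k<k' t<nk))
  ... | tri≈ _ refl _ = refl , +-cancelˡ-≡ (start n k) _ _ eq
  ... | tri> _ _ k'<k = contradiction (sym eq) (<⇒≢ (block-< k'<k t'<nk'))

  coordinates-< : start n k + t < start n k' + t' → t' < n k' → k < k' ⊎ (k ≡ k' × t < t')
  coordinates-< {k} {k' = k'} i<i' t'<nk' with <-cmp k k'
  ... | tri< k<k' _ _ = inj₁ k<k'
  ... | tri≈ _ refl _ = inj₂ (refl , +-cancelˡ-< (start n k) _ _ i<i')
  ... | tri> _ _ k'<k = contradiction i<i' (<-asym (block-< k'<k t'<nk'))

  coordinates : ∀ i → Coordinates i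
  coordinates zero = 0 , 0 , n>0 0 , refl
  coordinates (suc i) with coordinates i
  ... | k , t , t<nk , refl with m≤n⇒m<n∨m≡n t<nk
  ...   | inj₁ 1+t<nk = k , suc t , 1+t<nk , sym (+-suc (start n k) t)
  ...   | inj₂ 1+t≡nk = suc k , 0 , n>0 (suc k) , (begin
    suc (start n k + t)  ≡⟨ +-suc (start n k) t ⟨
    start n k + suc t    ≡⟨ cong (start n k +_) 1+t≡nk ⟩
    start n (suc k)      ≡⟨ +-identityʳ _ ⟨
    start n (suc k) + 0  ∎)
    where open ≡-Reasoning

  InI⇒coordinates : InI n k i → Σ ℕ λ t → t < n k × i ≡ start n k + t
  InI⇒coordinates {k = k} {i = i} (start≤i , i<next) =
    i ∸ start n k , +-cancelˡ-< (start n k) _ _ (subst (_< start n (suc k)) (sym i≡) i<next) , sym i≡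
    where
    i≡ : start n k + (i ∸ start n k) ≡ i
    i≡ = m+[n∸m]≡n start≤i

  coordinates⇒InI : t < n k → InI n k (start n k + t)
  coordinates⇒InI {k = k} t<nk = m≤m+n _ _ , +-monoʳ-< (start n k) t<nk

  InI-unique : InI n k i → InI n k' i → k ≡ k'
  InI-unique i∈Ik i∈Ik' with InI⇒coordinates i∈Ik | InI⇒coordinates i∈Ik'
  ... | _ , t<nk , refl | _ , t'<nk' , eq = proj₁ (coordinates-unique t<nk t'<nk' eq)

  Rot-coordinates : t < n k → Rot n (start n k + t) (start n k + rotate (n k) t)
  Rot-coordinates {t} {k} t<nk with suc t <? n k
  ... | yes 1+t<nk = k , coordinates⇒InI t<nk ,
    inj₁ (subst (_< start n (suc k)) (+-suc _ t) (+-monoʳ-< (start n k) 1+t<nk) , +-suc _ t)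
  ... | no 1+t≮nk = k , coordinates⇒InI t<nk ,
    inj₂ (trans (sym (+-suc _ t)) (cong (start n k +_) (≤∧≮⇒≡ t<nk 1+t≮nk)) , +-identityʳ _)

  Rot-coordinates⁻¹ : t < n k → Rot n (start n k + t) j → j ≡ start n k + rotate (n k) t
  Rot-coordinates⁻¹ {t} {k} t<nk (k' , i∈Ik' , r) with InI-unique (coordinates⇒InI t<nk) i∈Ik' | r
  ... | refl | inj₁ (1+i<next , refl) = begin
    suc (start n k + t)         ≡⟨ +-suc _ t ⟨
    start n k + suc t           ≡⟨ cong (start n k +_) (rotate-suc 1+t<nk) ⟨
    start n k + rotate (n k) t  ∎
    where
    open ≡-Reasoning
    1+t<nk : suc t < n k
    1+t<nk = +-cancelˡ-< (start n k) _ _ (subst (_< start n (suc k)) (sym (+-suc _ t)) 1+i<next)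
  ... | refl | inj₂ (1+i≡next , refl) = begin
    start n k                   ≡⟨ +-identityʳ _ ⟨
    start n k + 0               ≡⟨ cong (start n k +_) (rotate-last 1+t≡nk) ⟨
    start n k + rotate (n k) t  ∎
    where
    open ≡-Reasoning
    1+t≡nk : suc t ≡ n k
    1+t≡nk = +-cancelˡ-≡ (start n k) _ _ (trans (+-suc _ t) 1+i≡next)

  Rot-total : ∀ i → Σ ℕ (Rot n i)
  Rot-total i with coordinates i
  ... | _ , _ , t<nk , refl = _ , Rot-coordinates t<nk

  Rot-functional : ∀ {j j'} → Rot n i j → Rot n i j' → j ≡ j'
  Rot-functional {i} r r' with coordinates i
  ... | _ , _ , t<nk , refl = trans (Rot-coordinates⁻¹ t<nk r) (sym (Rot-coordinates⁻¹ t<nk r'))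

  Rot-source-≥ : Rot n i j → start n N ≤ j → N ≤ i
  Rot-source-≥ {i} r start≤j with coordinates i
  ... | k , t , t<nk , refl =
    ≤-trans (block-≤ (subst (_ ≤_) (Rot-coordinates⁻¹ t<nk r) start≤j) (rotate-< (n>0 k)))
            (block≤position k t)

  α-resp-=* : A =* B → α n A =* α n B
  α-resp-=* {A} {B} (N , A≈B) = start n N , λ j start≤j → transfer proj₁ start≤j , transfer proj₂ start≤j
    where
    transfer : ∀ {X Y : Subset} → (∀ {i} → (A i → B i) × (B i → A i) → X i → Y i) →
      start n N ≤ j → α n X j → α n Y j
    transfer pick start≤j (i , Xi , r) = i , pick (A≈B i (Rot-source-≥ r start≤j)) Xi , r

  α-union-of-orbits : UnionOfOrbits n D → α n D =* D
  α-union-of-orbits {D} orbits = always λ j → to , from j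
    where
    to : α n D j → D j
    to (i , Di , r) with coordinates i
    ... | k , t , t<nk , refl = orbits k _ _ (coordinates⇒InI t<nk)
      (subst (InI n k) (sym (Rot-coordinates⁻¹ t<nk r)) (coordinates⇒InI (rotate-< (n>0 k)))) Di
    from : ∀ j → D j → α n D j
    from j Dj with coordinates j
    ... | k , t , t<nk , refl with rotate-surjective t<nk
    ... | t' , t'<nk , rotate≡t = start n k + t' ,
      orbits k _ _ (coordinates⇒InI t<nk) (coordinates⇒InI t'<nk) Dj ,
      subst (Rot n _) (cong (start n k +_) rotate≡t) (Rot-coordinates {k = k} t'<nk)

  Full : Subset → ℕ → Set
  Full A k = ∀ {t} → t < n k → A (start n k + t)

  AllOrNothing : Subset → ℕ → Set
  AllOrNothing A k = ∀ {t} → t < n k → A (start n k + t) → Full A k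

  fixed⇒eventually-all-or-nothing : α n A =* A → Eventually (AllOrNothing A)
  fixed⇒eventually-all-or-nothing {A} (N , fixed) = N , λ k N≤k t<nk At t'<nk →
    rotate-invariant⇒constant (λ t → A (start n k + t)) (invariant k N≤k) t<nk t'<nk At
    where
    invariant : ∀ k → N ≤ k → t < n k → A (start n k + t) → A (start n k + rotate (n k) t)
    invariant k N≤k t<nk At =
      proj₁ (fixed _ (≤-trans N≤k (block≤position k _))) (_ , At , Rot-coordinates {k = k} t<nk)

  fixed⇒≈union-of-orbits : α n A =* A → Σ Subset λ D → UnionOfOrbits n D × (D =* A)
  fixed⇒≈union-of-orbits {A} fixed with fixed⇒eventually-all-or-nothing fixed
  ... | N , all-or-nothing = beyond , orbits , start n N , λ i start≤i → proj₂ , (start≤i ,_)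
    where
    beyond : Subset
    beyond i = start n N ≤ i × A i
    orbits : UnionOfOrbits n beyond
    orbits k i j i∈Ik j∈Ik (start≤i , Ai) with InI⇒coordinates i∈Ik | InI⇒coordinates j∈Ik
    ... | t , t<nk , refl | t' , t'<nk , refl =
      ≤-trans (strictly-increasing⇒monotone start-increasing N≤k) (m≤m+n _ t') ,
      all-or-nothing k N≤k t<nk Ai t'<nk
      where
      N≤k : N ≤ k
      N≤k = block-≤ start≤i t<nk

  ≈union-of-orbits⇒fixed : (Σ Subset λ D → UnionOfOrbits n D × (D =* A)) → α n A =* A
  ≈union-of-orbits⇒fixed (D , orbits , D≈A) =
    =*-trans (α-resp-=* (=*-sym D≈A)) (=*-trans (α-union-of-orbits orbits) D≈A)

  blocks : (ℕ → ℕ) → Subset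
  blocks σ i = Σ ℕ λ j → InI n (σ j) i

  fixed⇒≈full-blocks : ExcludedMiddle 0ℓ → ¬ (A =* ∅) → α n A =* A →
    Σ (ℕ → ℕ) λ σ → StrictlyIncreasing σ × (A =* blocks σ)
  fixed⇒≈full-blocks {A} em A≉∅ fixed with fixed⇒eventually-all-or-nothing fixed
  ... | N , all-or-nothing = enum , enum-increasing , start n N , λ i start≤i → to start≤i , from
    where
    LateFull : ℕ → Set
    LateFull k = N ≤ k × Full A k

    late-full-block : start n N ≤ start n k + t → t < n k → A (start n k + t) → LateFull k
    late-full-block {k} start≤i t<nk Ai = N≤k , all-or-nothing k N≤k t<nk Ai
      where
      N≤k : N ≤ k
      N≤k = block-≤ start≤i t<nk

    unbounded : ∀ s → Σ ℕ λ k → s ≤ k × LateFull k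
    unbounded s = em⇒dne em λ none → A≉∅ (start n (s + N) , λ i start≤i → none ∘ beyond-s start≤i , λ ())
      where
      beyond-s : start n (s + N) ≤ i → A i → Σ ℕ λ k → s ≤ k × LateFull k
      beyond-s {i} start≤i Ai with coordinates i
      ... | k , t , t<nk , refl = k , ≤-trans (m≤m+n s N) s+N≤k ,
        late-full-block (≤-trans (strictly-increasing⇒monotone start-increasing (m≤n+m N s)) start≤i) t<nk Ai
        where
        s+N≤k : s + N ≤ k
        s+N≤k = block-≤ start≤i t<nk

    open Enumeration (λ _ → em) unbounded

    to : start n N ≤ i → A i → blocks enum i
    to {i} start≤i Ai with coordinates i
    ... | k , t , t<nk , refl with enum-surjective (late-full-block start≤i t<nk Ai)
    ... | j , refl = j , coordinates⇒InI t<nk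

    from : blocks enum i → A i
    from (j , i∈I) with InI⇒coordinates i∈I
    ... | _ , t<n , refl = proj₂ (enum-holds j) t<n

image : (ℕ → ℕ) → Subset → Subset
image ψ x i = Σ ℕ λ p → x p × ψ p ≡ i

image-∪ : ∀ {ψ} → image ψ (x ∪ y) =* (image ψ x ∪ image ψ y)
image-∪ = always λ _ →
  (λ { (p , inj₁ xp , eq) → inj₁ (p , xp , eq) ; (p , inj₂ yp , eq) → inj₂ (p , yp , eq) }) ,
  (λ { (inj₁ (p , xp , eq)) → p , inj₁ xp , eq ; (inj₂ (p , yp , eq)) → p , inj₂ yp , eq })

image-≤*-range : ∀ {ψ} → image ψ x ≤* image ψ U
image-≤*-range = always λ _ (p , _ , eq) → p , tt , eq

image-preimage : ∀ {ψ} → y ≤* image ψ U → image ψ (ψ ⊢ y) =* y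
image-preimage {y} (N , y≤range) = N , λ i N≤i →
  (λ { (p , yψp , refl) → yψp }) ,
  (λ yi → let (p , _ , ψp≡i) = y≤range i N≤i yi in p , subst y (sym ψp≡i) yi , ψp≡i)

module _ {ψ : ℕ → ℕ} (ψ-increasing : StrictlyIncreasing ψ) where

  image⁻¹ : ∀ {p} → image ψ x (ψ p) → x p
  image⁻¹ {x} (q , xq , ψq≡ψp) = subst x (strictly-increasing⇒injective ψ-increasing ψq≡ψp) xq

  image-resp-=* : x =* y → image ψ x =* image ψ y
  image-resp-=* {x} {y} (N , x≈y) = ψ N , λ i ψN≤i → transfer proj₁ ψN≤i , transfer proj₂ ψN≤i
    where
    transfer : ∀ {X Y : Subset} → (∀ {p} → (x p → y p) × (y p → x p) → X p → Y p) →
      ψ N ≤ i → image ψ X i → image ψ Y i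
    transfer pick ψN≤i (p , Xp , refl) =
      p , pick (x≈y p (strictly-increasing-reflects-≤ ψ-increasing ψN≤i)) Xp , refl

  image-reflects-=* : image ψ x =* image ψ y → x =* y
  image-reflects-=* (N , ψx≈ψy) = N , λ p N≤p →
    let ψp-beyond = ≤-trans N≤p (strictly-increasing⇒inflationary ψ-increasing p)
        (to , from) = ψx≈ψy (ψ p) ψp-beyond
    in (λ xp → image⁻¹ (to (p , xp , refl))) , (λ yp → image⁻¹ (from (p , yp , refl)))

  image-∩ : image ψ (x ∩ y) =* (image ψ x ∩ image ψ y)
  image-∩ = always λ _ →
    (λ (p , (xp , yp) , eq) → (p , xp , eq) , (p , yp , eq)) ,
    (λ { ((p , xp , refl) , ψy) → p , (xp , image⁻¹ ψy) , refl })

  image-∁ : image ψ (∁ x) =* (image ψ U ∩ ∁ (image ψ x))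
  image-∁ = always λ _ →
    (λ { (p , ¬xp , refl) → (p , tt , refl) , λ ψx → ¬xp (image⁻¹ ψx) }) ,
    (λ { ((p , _ , refl) , ¬ψx) → p , (λ xp → ¬ψx (p , xp , refl)) , refl })

module SubsequenceEmbedding (n : ℕ → ℕ) (n>0 : ∀ k → 0 < n k)
                            {σ : ℕ → ℕ} (σ-increasing : StrictlyIncreasing σ) where

  open Blocks n n>0
  private module Sub = Blocks (n ∘ σ) (n>0 ∘ σ)

  embed : ℕ → ℕ
  embed p = let (j , t , _) = Sub.coordinates p in start n (σ j) + t

  embed-coordinates : t < n (σ j) → embed (start (n ∘ σ) j + t) ≡ start n (σ j) + t
  embed-coordinates {t} {j} t<mj with Sub.coordinates (start (n ∘ σ) j + t)
  ... | j' , t' , t'<mj' , eq with Sub.coordinates-unique t<mj t'<mj' eq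
  ... | refl , refl = refl

  embed-increasing : StrictlyIncreasing embed
  embed-increasing {p} {q} p<q with Sub.coordinates p | Sub.coordinates q
  ... | j , t , t<mj , refl | j' , t' , t'<mj' , refl =
    lexicographic (Sub.coordinates-< p<q t'<mj')
    where
    lexicographic : j < j' ⊎ (j ≡ j' × t < t') → start n (σ j) + t < start n (σ j') + t'
    lexicographic (inj₁ j<j')         = block-< (σ-increasing j<j') t<mj
    lexicographic (inj₂ (refl , t<t')) = +-monoʳ-< (start n (σ j)) t<t'

  embed-Rot : ∀ {p q} → Rot (n ∘ σ) p q → Rot n (embed p) (embed q)
  embed-Rot {p} r with Sub.coordinates p
  ... | j , t , t<mj , refl =
    subst (Rot n _)
      (sym (trans (cong embed (Sub.Rot-coordinates⁻¹ t<mj r)) (embed-coordinates (rotate-< (n>0 (σ j))))))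
      (Rot-coordinates {k = σ j} t<mj)

  image-α : image embed (α (n ∘ σ) x) =* α n (image embed x)
  image-α = always λ _ →
    (λ { (q , (p , xp , r) , refl) → embed p , (p , xp , refl) , embed-Rot r }) ,
    (λ { (_ , (p , xp , refl) , r) → let (q , r') = Sub.Rot-total p in
           q , (p , xp , r') , Rot-functional (embed-Rot r') r })

  range-embed : image embed U =* blocks σ
  range-embed = always λ _ → to , from
    where
    to : image embed U i → blocks σ i
    to (p , _ , refl) with Sub.coordinates p
    ... | j , t , t<mj , refl = j , coordinates⇒InI t<mj
    from : blocks σ i → image embed U i
    from (j , i∈I) with InI⇒coordinates i∈I
    ... | t , t<mj , refl = start (n ∘ σ) j + t , tt , embed-coordinates t<mj

  embed-isConjugacy : IsConjugacy n (n ∘ σ) (image embed U) (image embed)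
  embed-isConjugacy = record
    { resp   = λ _ _ → image-resp-=* embed-increasing
    ; below  = λ _ → image-≤*-range
    ; pres-∩ = λ _ _ → image-∩ embed-increasing
    ; pres-∪ = λ _ _ → image-∪
    ; pres-∁ = λ _ → image-∁ embed-increasing
    ; inj    = λ _ _ → image-reflects-=* embed-increasing
    ; surj   = λ y y≤range → embed ⊢ y , image-preimage y≤range
    ; comm   = λ _ → image-α
    }

IsConjugacy-resp-=* : ∀ {d d' φ} → d =* d' → IsConjugacy n m d φ → IsConjugacy n m d' φ
IsConjugacy-resp-=* d≈d' conj = record
  { resp   = resp
  ; below  = λ x → ≤*-resp-=* (below x) d≈d'
  ; pres-∩ = pres-∩
  ; pres-∪ = pres-∪
  ; pres-∁ = λ x → =*-trans (pres-∁ x) (∩-congˡ-=* d≈d')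
  ; inj    = inj
  ; surj   = λ y y≤d' → surj y (≤*-resp-=* y≤d' (=*-sym d≈d'))
  ; comm   = comm
  }
  where open IsConjugacy conj

fixed⇒conjugate-to-subsequence : ExcludedMiddle 0ℓ → (n>0 : ∀ k → 0 < n k) →
  ¬ (A =* ∅) → α n A =* A →
  Σ (ℕ → ℕ) λ m → Subsequence m n × (Σ (Subset → Subset) λ φ → IsConjugacy n m A φ)
fixed⇒conjugate-to-subsequence {n} em n>0 A≉∅ fixed
  with Blocks.fixed⇒≈full-blocks n n>0 em A≉∅ fixed
... | σ , σ-increasing , A≈blocks =
  n ∘ σ , (σ , (λ j → σ-increasing (n<1+n j)) , (λ _ → refl)) , image embed ,
  IsConjugacy-resp-=* (=*-trans range-embed (=*-sym A≈blocks)) embed-isConjugacy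
  where open SubsequenceEmbedding n n>0 σ-increasing

lemma4p7 : ExcludedMiddle 0ℓ → (n : ℕ → ℕ) → (∀ j → 0 < n j) →
    ((A : Subset) →
      ((α n A =* A → Σ Subset λ D → UnionOfOrbits n D × (D =* A))
      × ((Σ Subset λ D → UnionOfOrbits n D × (D =* A)) → α n A =* A)))
    × ((A : Subset) → ¬ (A =* ∅) → α n A =* A →
      Σ (ℕ → ℕ) λ m → Subsequence m n × (Σ (Subset → Subset) λ φ → IsConjugacy n m A φ))
lemma4p7 em n n>0 =
  (λ _ → fixed⇒≈union-of-orbits , ≈union-of-orbits⇒fixed) ,
  (λ _ → fixed⇒conjugate-to-subsequence em n>0)
  where open Blocks n n>0
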